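{- Let $G$ be a finite simple graph with order $n$, girth $g$ (with $3\le g<\infty$), minimum degree $\delta\ge 2$ and equator $q$, and let $k=\lceil g/2\rceil-1$. If $q>6k+3$, then \[ n\ \ge\ \frac{q}{g}\,M(\delta,g). \]
   Context: The girth is the length of a shortest cycle. A cycle $C$ in $G$ is isometric if $d_C(x,y)=d_G(x,y)$ for all vertices $x,y$ of $C$. The equator of $G$ is the length of a longest isometric cycle of $G$. The Moore bound is defined for integers $\delta\ge 2$, $g\ge 3$, with $k=\lceil g/2\rceil-1$, by $M(\delta,g)=1+\sum_{i=0}^{k-1}\delta(\delta-1)^i$ if $g$ is odd and $M(\delta,g)=2+\sum_{i=1}^{k}2(\delta-1)^i$ if $g$ is even. -}

module Defs where

open import Data.Nat using (ℕ; zero; suc; _+_; _*_; _∸_; _^_; _≤_; _<_; _⊓_; ∣_-_∣; _/_)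
open import Data.Bool using (Bool; true; false; if_then_else_)
open import Data.Fin using (Fin; toℕ)
open import Data.List using (List; allFin; filter; length)
open import Data.Product using (Σ; ∃; _×_; _,_)
open import Data.Sum using (_⊎_)
open import Data.Empty using (⊥)
open import Relation.Binary.PropositionalEquality using (_≡_; _≢_)
open import Relation.Nullary using (¬_)
open import Function.Definitions using (Injective)

record Graph (n : ℕ) : Set where
  field
    adj    : Fin n → Fin n → Bool
    symm   : ∀ x y → adj x y ≡ adj y x
    irrefl : ∀ x → adj x x ≡ false
open Graph public

Adj : ∀ {n} → Graph n → Fin n → Fin n → Set
Adj G x y = adj G x y ≡ true

degree : ∀ {n} → Graph n → Fin n → ℕ
degree {n} G v = length (filter (λ w → Data.Bool._≟_ (adj G v w) true) (allFin n))
  where import Data.Bool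

MinDegree : ∀ {n} → Graph n → ℕ → Set
MinDegree {n} G δ = (∀ v → δ ≤ degree G v) × (∃ λ v → degree G v ≡ δ)

data Walk {n} (G : Graph n) : Fin n → Fin n → ℕ → Set where
  nil  : ∀ x → Walk G x x 0
  cons : ∀ {x y z ℓ} → Adj G x y → Walk G y z ℓ → Walk G x z (suc ℓ)

Dist : ∀ {n} → Graph n → Fin n → Fin n → ℕ → Set
Dist G x y d = Walk G x y d × (∀ ℓ → Walk G x y ℓ → d ≤ ℓ)

Consecutive : (L : ℕ) → Fin L → Fin L → Set
Consecutive L i j = suc (toℕ i) ≡ toℕ j ⊎ (suc (toℕ i) ≡ L × toℕ j ≡ 0)

record Cycle {n} (G : Graph n) (L : ℕ) : Set where
  field
    three≤L : 3 ≤ L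
    vtx     : Fin L → Fin n
    inj     : Injective _≡_ _≡_ vtx
    edges   : ∀ i j → Consecutive L i j → Adj G (vtx i) (vtx j)
open Cycle public

cycDist : (L : ℕ) → Fin L → Fin L → ℕ
cycDist L i j = ∣ toℕ i - toℕ j ∣ ⊓ (L ∸ ∣ toℕ i - toℕ j ∣)

Isometric : ∀ {n} {G : Graph n} {L} → Cycle G L → Set
Isometric {G = G} {L} C = ∀ i j → Dist G (vtx C i) (vtx C j) (cycDist L i j)

Girth : ∀ {n} → Graph n → ℕ → Set
Girth G g = Cycle G g × (∀ L → Cycle G L → g ≤ L)

Equator : ∀ {n} → Graph n → ℕ → Set
Equator G q = (Σ (Cycle G q) Isometric) × (∀ L (C : Cycle G L) → Isometric C → L ≤ q)

sumBelow : ℕ → (ℕ → ℕ) → ℕ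
sumBelow zero    f = 0
sumBelow (suc m) f = sumBelow m f + f m

-- k = ⌈g/2⌉ - 1 = ⌊(g+1)/2⌋ - 1
kOf : ℕ → ℕ
kOf g = ((g + 1) / 2) ∸ 1

isOdd : ℕ → Bool
isOdd zero = false
isOdd (suc zero) = true
isOdd (suc (suc m)) = isOdd m

Moore : ℕ → ℕ → ℕ
Moore δ g = if isOdd g
  then 1 + sumBelow (kOf g) (λ i → δ * (δ ∸ 1) ^ i)
  else 2 + sumBelow (kOf g) (λ i → 2 * (δ ∸ 1) ^ (suc i))

-- Double counting along an isometric cycle C = c 0, …, c (q - 1), with k = ⌈g/2⌉ - 1.
-- To each position i attach the set H i of endpoints of the simple paths with at most k
-- edges that leave c i (g odd), or that leave the edge c i c (i+1) on either side (g even).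
-- Since 2k < g, two such paths with a common endpoint would close a cycle shorter than g,
-- so the endpoints are distinct and the Moore-tree count gives |H i| ≥ M(δ,g).  Conversely,
-- w ∈ H i forces w to be within distance k of c i (or of c (i+1)).  As C is isometric, the
-- positions within distance k of w are pairwise at most 2k apart along C, and since 6k < q
-- they lie in an arc of 2k+1 consecutive positions.  So w lies in at most 2k+1 = g of the
-- sets H i when g is odd, and in at most 2k+2 = g when g is even.  Hence
-- q · M(δ,g) ≤ Σᵢ |H i| ≤ n · g.

module Submission where

open import Defs
open import Level using (0ℓ)
open import Data.Nat
  using (ℕ; zero; suc; _+_; _*_; _∸_; _^_; _≤_; _<_; _⊓_; ∣_-_∣; _%_; z≤n; s≤s; _≤?_; _<?_)
open import Data.Nat.DivMod
  using (_/_; _mod_; %-distribˡ-+; m%n%n≡m%n; [m+n]%n≡m%n; m<n⇒m%n≡m; m%n<n; n%n≡0)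
open import Data.Nat.DivMod.Core using (divₕ-extractAcc)
open import Data.Nat.Properties
open import Data.Nat.Tactic.RingSolver using (solve-∀)
open import Data.Bool using (true; false; if_then_else_)
import Data.Bool as Bool
open import Data.Fin using (Fin; zero; suc; toℕ)
import Data.Fin.Properties as Fin
open import Data.List
  using (List; []; _∷_; [_]; _++_; _∷ʳ_; _ʳ++_; length; lookup; map; filter; concatMap; allFin; upTo)
open import Data.List.Properties
  using (≡-dec; ++-identityʳ; length-++; length-ʳ++; ++-ʳ++; ∷ʳ-++; length-map; length-upTo;
         filter-all; ∷-injectiveˡ; ∷-injectiveʳ)
open import Data.List.Membership.Propositional using (_∈_; _∉_; find)
import Data.List.Membership.DecPropositional as DecMembership
open import Data.List.Membership.Propositional.Properties
  using (∈-++⁺ˡ; ∈-++⁺ʳ; ∈-++⁻; ∈-∃++; ∈-lookup; ∈-map⁺; ∈-map⁻; ∈-upTo⁺;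
         ∈-filter⁻; ∈-concatMap⁻)
open import Data.List.Relation.Unary.Any using (Any; here; there)
open import Data.List.Relation.Unary.All as All using (All; []; _∷_)
import Data.List.Relation.Unary.All.Properties as All
import Data.List.Relation.Unary.Any.Properties as Any
open import Data.List.Relation.Unary.AllPairs using ([]; _∷_)
open import Data.List.Relation.Unary.Unique.Propositional using (Unique)
import Data.List.Relation.Unary.Unique.Propositional.Properties as Unique
open import Data.List.Relation.Unary.Linked as Linked using (Linked; []; [-]; _∷_)
import Data.List.Relation.Unary.First as First
open import Data.List.Relation.Unary.First.Properties using (toView)
open import Data.List.Relation.Binary.Disjoint.Propositional using (Disjoint)
open import Data.Product using (∃; ∃₂; _×_; _,_; proj₁; proj₂)
open import Data.Sum using (_⊎_; inj₁; inj₂)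
open import Data.Empty using (⊥-elim)
open import Relation.Nullary using (¬_; ¬?; _×-dec_; Dec; yes; no; does; contradiction)
open import Relation.Nullary.Decidable using (toSum)
open import Relation.Unary using (Pred; Decidable; ∁)
open import Relation.Binary.Definitions using (Symmetric)
open import Relation.Binary.PropositionalEquality hiding ([_]; J)
open import Function using (_∘_)
open import Algebra.Properties.CommutativeMonoid.Sum +-0-commutativeMonoid
  using (sum-syntax; ∑-comm; ∑-distrib-+; sum-replicate-zero)
open import Algebra.Properties.CommutativeSemigroup *-commutativeSemigroup using (x∙yz≈y∙xz)

module _ {A : Set} where

  headOr : A → List A → A
  headOr d []      = d
  headOr d (x ∷ _) = x

  headOr-++-∷ : ∀ (xs : List A) {y d e ys zs} → headOr d (xs ++ y ∷ ys) ≡ headOr e (xs ++ y ∷ zs)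
  headOr-++-∷ []      = refl
  headOr-++-∷ (_ ∷ _) = refl

  Unique-++⁻ : ∀ xs {ys : List A} → Unique (xs ++ ys) → Unique xs × Unique ys × Disjoint xs ys
  Unique-++⁻ []       u = [] , u , λ { (() , _) }
  Unique-++⁻ (x ∷ xs) (x∉ ∷ u) with uxs , uys , xs#ys ← Unique-++⁻ xs u =
    All.++⁻ˡ xs x∉ ∷ uxs , uys , λ where
      (here refl  , v∈ys) → All.lookup (All.++⁻ʳ xs x∉) v∈ys refl
      (there v∈xs , v∈ys) → xs#ys (v∈xs , v∈ys)

  Unique-∷ʳ : ∀ xs {y : A} {ys} → Unique (xs ++ y ∷ ys) → Unique (xs ∷ʳ y)
  Unique-∷ʳ xs {y} {ys} u = proj₁ (Unique-++⁻ (xs ∷ʳ y) (subst Unique (sym (∷ʳ-++ xs y ys)) u))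

  Unique-ʳ++ : ∀ xs {ys : List A} → Unique xs → Unique ys → Disjoint xs ys → Unique (xs ʳ++ ys)
  Unique-ʳ++ []       _          uys _     = uys
  Unique-ʳ++ (x ∷ xs) {ys} (x∉xs ∷ uxs) uys xs#ys =
    Unique-ʳ++ xs uxs (x∉ys ∷ uys) λ where
      (v∈xs , here refl)  → All.lookup x∉xs v∈xs refl
      (v∈xs , there v∈ys) → xs#ys (there v∈xs , v∈ys)
    where
    x∉ys : All (x ≢_) ys
    x∉ys = All.tabulate λ v∈ys x≡v → xs#ys (here (sym x≡v) , v∈ys)

  ∈-ʳ++⁻ : ∀ xs {ys : List A} {v} → v ∈ xs ʳ++ ys → v ∈ xs ⊎ v ∈ ys
  ∈-ʳ++⁻ []       v∈ = inj₂ v∈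
  ∈-ʳ++⁻ (x ∷ xs) v∈ with ∈-ʳ++⁻ xs v∈
  ... | inj₁ v∈xs         = inj₁ (there v∈xs)
  ... | inj₂ (here refl)  = inj₁ (here refl)
  ... | inj₂ (there v∈ys) = inj₂ v∈ys

  Unique-∷-++ : ∀ xs {y : A} {ys} → Unique (xs ++ y ∷ ys) → Unique (y ∷ xs)
  Unique-∷-++ xs u with uxs , _ , xs#y∷ys ← Unique-++⁻ xs u =
    All.tabulate (λ v∈xs y≡v → xs#y∷ys (v∈xs , here (sym y≡v))) ∷ uxs

  length-++-∷ : ∀ (xs : List A) {y ys} → suc (length xs) ≤ length (xs ++ y ∷ ys)
  length-++-∷ xs {y} {ys} = begin
    suc (length xs)                ≤⟨ s≤s (m≤m+n (length xs) (length ys)) ⟩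
    suc (length xs + length ys)    ≡⟨ +-suc (length xs) (length ys) ⟨
    length xs + length (y ∷ ys)    ≡⟨ length-++ xs ⟨
    length (xs ++ y ∷ ys)          ∎
    where open ≤-Reasoning

  ʳ++-++ : ∀ (xs : List A) {ys zs} → xs ʳ++ (ys ++ zs) ≡ (xs ʳ++ ys) ++ zs
  ʳ++-++ []       = refl
  ʳ++-++ (x ∷ xs) = ʳ++-++ xs

  length-∷ʳ : ∀ (xs : List A) {x} → length (xs ∷ʳ x) ≡ suc (length xs)
  length-∷ʳ xs = trans (length-++ xs) (+-comm (length xs) 1)

  length-prefix : ∀ xs {a} F {y R} → xs ∷ʳ a ≡ F ++ y ∷ R → length F ≤ length xs
  length-prefix xs {a} F {y} {R} eq = ≤-pred (begin
    suc (length F)        ≤⟨ length-++-∷ F ⟩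
    length (F ++ y ∷ R)   ≡⟨ cong length eq ⟨
    length (xs ∷ʳ a)      ≡⟨ length-∷ʳ xs ⟩
    suc (length xs)       ∎)
    where open ≤-Reasoning

  distinct-heads⇒nonempty : ∀ F B {y d e R R′} → headOr d (F ++ y ∷ R) ≢ headOr e (B ++ y ∷ R′) →
                            2 ≤ length B + suc (length F)
  distinct-heads⇒nonempty []      []      differ = ⊥-elim (differ refl)
  distinct-heads⇒nonempty []      (_ ∷ B) _      = s≤s (m≤n+m 1 (length B))
  distinct-heads⇒nonempty (_ ∷ F) B       _      = ≤-trans (s≤s (s≤s z≤n)) (m≤n+m _ (length B))

  split-at-first : {P : Pred A 0ℓ} → Decidable P → ∀ {xs} → Any P xs →
                   ∃₂ λ F y → ∃ λ R → xs ≡ F ++ y ∷ R × All (∁ P) F × P y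
  split-at-first P? any with toView (First.refine (λ {x} _ → toSum (P? x)) (First.fromAny any))
  ... | First._++_∷_ ¬pF py R = _ , _ , R , refl , ¬pF , py

  Unique-map⁺ : ∀ {B : Set} (f : A → B) {xs} →
                (∀ {x y} → x ∈ xs → y ∈ xs → f x ≡ f y → x ≡ y) → Unique xs → Unique (map f xs)
  Unique-map⁺ f {[]}     _   _           = []
  Unique-map⁺ f {x ∷ xs} inj (x∉xs ∷ u) =
    All.map⁺ (All.tabulate λ y∈xs fx≡fy → All.lookup x∉xs y∈xs (inj (here refl) (there y∈xs) fx≡fy))
    ∷ Unique-map⁺ f (λ x∈ y∈ → inj (there x∈) (there y∈)) u

  Unique-concatMap⁺ : ∀ {B : Set} (f : A → List B) {xs} → Unique xs → (∀ x → Unique (f x)) →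
                      (∀ {x y v} → v ∈ f x → v ∈ f y → x ≡ y) → Unique (concatMap f xs)
  Unique-concatMap⁺ f {[]}     _          _  _     = []
  Unique-concatMap⁺ f {x ∷ xs} (x∉xs ∷ u) uf inj =
    Unique.++⁺ (uf x) (Unique-concatMap⁺ f u uf inj) λ (v∈fx , v∈rest) →
      let y , y∈xs , v∈fy = find (∈-concatMap⁻ f {xs = xs} v∈rest)
      in All.lookup x∉xs y∈xs (inj v∈fx v∈fy)

  length-concatMap-≥ : ∀ {B : Set} (f : A → List B) c xs → (∀ {x} → x ∈ xs → c ≤ length (f x)) →
                       c * length xs ≤ length (concatMap f xs)
  length-concatMap-≥ f c []       _ = ≤-reflexive (*-zeroʳ c)
  length-concatMap-≥ f c (x ∷ xs) h = begin
    c * suc (length xs)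
      ≡⟨ *-suc c (length xs) ⟩
    c + c * length xs
      ≤⟨ +-mono-≤ (h (here refl)) (length-concatMap-≥ f c xs (h ∘ there)) ⟩
    length (f x) + length (concatMap f xs)
      ≡⟨ length-++ (f x) ⟨
    length (concatMap f (x ∷ xs))
      ∎
    where open ≤-Reasoning

  length-filter-all-but-one : ∀ {P : Pred A 0ℓ} (P? : Decidable P) {c} xs → Unique xs →
                              (∀ {x} → x ∈ xs → P x ⊎ x ≡ c) → length xs ≤ suc (length (filter P? xs))
  length-filter-all-but-one P? []       _          _ = z≤n
  length-filter-all-but-one {P} P? (x ∷ xs) (x∉xs ∷ u) h with P? x | h (here refl)
  ... | yes _  | _        = s≤s (length-filter-all-but-one P? xs u (h ∘ there))
  ... | no ¬px | inj₁ px  = contradiction px ¬px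
  ... | no _   | inj₂ refl = s≤s (≤-reflexive (cong length (sym (filter-all P? (All.tabulate P-on-xs)))))
    where
    P-on-xs : ∀ {y} → y ∈ xs → P y
    P-on-xs y∈xs with h (there y∈xs)
    ... | inj₁ py    = py
    ... | inj₂ refl  = contradiction refl (All.lookup x∉xs y∈xs)

  module _ {R : A → A → Set} where

    Linked-++⁻ˡ : ∀ xs {ys} → Linked R (xs ++ ys) → Linked R xs
    Linked-++⁻ˡ []           _         = []
    Linked-++⁻ˡ (x ∷ [])     _         = [-]
    Linked-++⁻ˡ (x ∷ y ∷ xs) (r ∷ rs) = r ∷ Linked-++⁻ˡ (y ∷ xs) rs

    Linked-∷ʳ : ∀ xs {y ys} → Linked R (xs ++ y ∷ ys) → Linked R (xs ∷ʳ y)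
    Linked-∷ʳ xs {y} {ys} rs = Linked-++⁻ˡ (xs ∷ʳ y) (subst (Linked R) (sym (∷ʳ-++ xs y ys)) rs)

    Linked-ʳ++ : Symmetric R →
                 ∀ {x} xs {ys} → Linked R (x ∷ xs) → Linked R (x ∷ ys) → Linked R (xs ʳ++ x ∷ ys)
    Linked-ʳ++ sym-R []       _        rs = rs
    Linked-ʳ++ sym-R (x ∷ xs) (r ∷ rs′) rs = Linked-ʳ++ sym-R xs rs′ (sym-R r ∷ rs)

-- Indicator sums and double counting

⟦_⟧ : ∀ {P : Set} → Dec P → ℕ
⟦ P? ⟧ = if does P? then 1 else 0

⟦⟧-mono : ∀ {P Q : Set} → (P → Q) → (P? : Dec P) (Q? : Dec Q) → ⟦ P? ⟧ ≤ ⟦ Q? ⟧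
⟦⟧-mono P⇒Q (yes p) (no ¬q) = contradiction (P⇒Q p) ¬q
⟦⟧-mono P⇒Q (yes _) (yes _) = ≤-refl
⟦⟧-mono P⇒Q (no _)  _       = z≤n

∑-mono-≤ : ∀ {m} {f h : Fin m → ℕ} → (∀ i → f i ≤ h i) → ∑[ i < m ] f i ≤ ∑[ i < m ] h i
∑-mono-≤ {zero}  _   = z≤n
∑-mono-≤ {suc m} f≤h = +-mono-≤ (f≤h zero) (∑-mono-≤ (f≤h ∘ suc))

∑-const : ∀ m c → ∑[ i < m ] c ≡ m * c
∑-const zero    c = refl
∑-const (suc m) c = cong (c +_) (∑-const m c)

∑-⟦≟⟧ : ∀ {n} (x : Fin n) → ∑[ w < n ] ⟦ w Fin.≟ x ⟧ ≡ 1
∑-⟦≟⟧ {suc n} zero    = cong suc (sum-replicate-zero n)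
∑-⟦≟⟧ {suc n} (suc x) = ∑-⟦≟⟧ x

∑-⟦≟⟧-+ : ∀ {n} (x : Fin n) (f : Fin n → ℕ) →
          ∑[ w < n ] (⟦ w Fin.≟ x ⟧ + f w) ≡ suc (∑[ w < n ] f w)
∑-⟦≟⟧-+ {n} x f =
  trans (∑-distrib-+ (λ w → ⟦ w Fin.≟ x ⟧) f) (cong (_+ ∑[ w < n ] f w) (∑-⟦≟⟧ x))

module _ {n : ℕ} where
  open DecMembership (Fin._≟_ {n}) using (_∈?_)

  private
    ⟦∈?∷⟧-≤ : ∀ w x xs → ⟦ w ∈? x ∷ xs ⟧ ≤ ⟦ w Fin.≟ x ⟧ + ⟦ w ∈? xs ⟧
    ⟦∈?∷⟧-≤ w x xs with w Fin.≟ x | w ∈? xs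
    ... | yes _ | _     = s≤s z≤n
    ... | no _  | yes _ = ≤-refl
    ... | no _  | no _  = z≤n

    ⟦∈?∷⟧-≥ : ∀ w x xs → x ∉ xs → ⟦ w Fin.≟ x ⟧ + ⟦ w ∈? xs ⟧ ≤ ⟦ w ∈? x ∷ xs ⟧
    ⟦∈?∷⟧-≥ w x xs x∉xs with w Fin.≟ x | w ∈? xs
    ... | yes refl | yes w∈xs = contradiction w∈xs x∉xs
    ... | yes _    | no _     = ≤-refl
    ... | no _     | yes _    = ≤-refl
    ... | no _     | no _     = z≤n

  ∑-⟦∈?⟧-≤ : ∀ xs → ∑[ w < n ] ⟦ w ∈? xs ⟧ ≤ length xs
  ∑-⟦∈?⟧-≤ []       = ≤-reflexive (sum-replicate-zero n)
  ∑-⟦∈?⟧-≤ (x ∷ xs) = begin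
    ∑[ w < n ] ⟦ w ∈? x ∷ xs ⟧                 ≤⟨ ∑-mono-≤ (λ w → ⟦∈?∷⟧-≤ w x xs) ⟩
    ∑[ w < n ] (⟦ w Fin.≟ x ⟧ + ⟦ w ∈? xs ⟧)   ≡⟨ ∑-⟦≟⟧-+ x (λ w → ⟦ w ∈? xs ⟧) ⟩
    suc (∑[ w < n ] ⟦ w ∈? xs ⟧)               ≤⟨ s≤s (∑-⟦∈?⟧-≤ xs) ⟩
    suc (length xs)                            ∎
    where open ≤-Reasoning

  length-≤-∑-⟦∈?⟧ : ∀ {xs} → Unique xs → length xs ≤ ∑[ w < n ] ⟦ w ∈? xs ⟧
  length-≤-∑-⟦∈?⟧ {[]}     _          = z≤n
  length-≤-∑-⟦∈?⟧ {x ∷ xs} (x≢xs ∷ u) = begin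
    suc (length xs)                            ≤⟨ s≤s (length-≤-∑-⟦∈?⟧ u) ⟩
    suc (∑[ w < n ] ⟦ w ∈? xs ⟧)               ≡⟨ ∑-⟦≟⟧-+ x (λ w → ⟦ w ∈? xs ⟧) ⟨
    ∑[ w < n ] (⟦ w Fin.≟ x ⟧ + ⟦ w ∈? xs ⟧)   ≤⟨ ∑-mono-≤ (λ w → ⟦∈?∷⟧-≥ w x xs x∉xs) ⟩
    ∑[ w < n ] ⟦ w ∈? x ∷ xs ⟧                 ∎
    where
    open ≤-Reasoning
    x∉xs : x ∉ xs
    x∉xs = All.All¬⇒¬Any x≢xs

  ∑-⟦⟧-≤-length : ∀ {P : Pred (Fin n) 0ℓ} (P? : Decidable P) xs → (∀ {i} → P i → i ∈ xs) →
                  ∑[ i < n ] ⟦ P? i ⟧ ≤ length xs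
  ∑-⟦⟧-≤-length P? xs P⊆xs =
    ≤-trans (∑-mono-≤ (λ i → ⟦⟧-mono P⊆xs (P? i) (i ∈? xs))) (∑-⟦∈?⟧-≤ xs)

  double-counting : ∀ {q} M g (H : Fin q → List (Fin n)) → (∀ i → Unique (H i)) →
                    (∀ i → M ≤ length (H i)) → (∀ w → ∑[ i < q ] ⟦ w ∈? H i ⟧ ≤ g) →
                    q * M ≤ n * g
  double-counting {q} M g H unique M≤ ≤g = begin
    q * M                                   ≡⟨ ∑-const q M ⟨
    ∑[ i < q ] M                            ≤⟨ ∑-mono-≤ M≤ ⟩
    ∑[ i < q ] length (H i)                 ≤⟨ ∑-mono-≤ (λ i → length-≤-∑-⟦∈?⟧ (unique i)) ⟩
    ∑[ i < q ] ∑[ w < n ] ⟦ w ∈? H i ⟧      ≡⟨ ∑-comm (λ i w → ⟦ w ∈? H i ⟧) ⟩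
    ∑[ w < n ] ∑[ i < q ] ⟦ w ∈? H i ⟧      ≤⟨ ∑-mono-≤ ≤g ⟩
    ∑[ w < n ] g                            ≡⟨ ∑-const n g ⟩
    n * g                                   ∎
    where open ≤-Reasoning

-- Simple paths and the girth

module Paths {n : ℕ} (G : Graph n) where

  V : Set
  V = Fin n

  open DecMembership (Fin._≟_ {n}) using (_∈?_)

  _~_ : V → V → Set
  _~_ = Adj G

  ~-sym : ∀ {x y} → x ~ y → y ~ x
  ~-sym {x} {y} = trans (symm G y x)

  ~-irrefl : ∀ {x} → ¬ x ~ x
  ~-irrefl {x} x~x with () ← trans (sym x~x) (irrefl G x)

  _~?_ : ∀ u w → Dec (u ~ w)
  u ~? w = adj G u w Bool.≟ true

  SimplePath : List V → Set
  SimplePath p = Unique p × Linked _~_ p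

  vertex-SimplePath : ∀ {a} → SimplePath [ a ]
  vertex-SimplePath = [] ∷ [] , [-]

  walk-snoc : ∀ {x y z l} → Walk G x y l → y ~ z → Walk G x z (suc l)
  walk-snoc (nil x)    y~z = cons y~z (nil _)
  walk-snoc (cons e w) y~z = cons e (walk-snoc w y~z)

  walk-reverse : ∀ {x y l} → Walk G x y l → Walk G y x l
  walk-reverse (nil x)    = nil x
  walk-reverse (cons e w) = walk-snoc (walk-reverse w) (~-sym e)

  walk-++ : ∀ {x y z l m} → Walk G x y l → Walk G y z m → Walk G x z (l + m)
  walk-++ (nil x)    w′ = w′
  walk-++ (cons e w) w′ = cons e (walk-++ w w′)

  Linked⇒Walk : ∀ xs {a} → Linked _~_ (xs ∷ʳ a) → Walk G (headOr a (xs ∷ʳ a)) a (length xs)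
  Linked⇒Walk []           _        = nil _
  Linked⇒Walk (x ∷ [])     (e ∷ [-]) = cons e (nil _)
  Linked⇒Walk (x ∷ y ∷ xs) (e ∷ es) = cons e (Linked⇒Walk (y ∷ xs) es)

  private
    lookup-injective : ∀ (xs : List V) → Unique xs → ∀ {i j} → lookup xs i ≡ lookup xs j → i ≡ j
    lookup-injective (x ∷ xs) u         {zero}  {zero}  _  = refl
    lookup-injective (x ∷ xs) (x∉ ∷ _) {zero}  {suc j} eq = ⊥-elim (All.lookup x∉ (∈-lookup j) eq)
    lookup-injective (x ∷ xs) (x∉ ∷ _) {suc i} {zero}  eq = ⊥-elim (All.lookup x∉ (∈-lookup i) (sym eq))
    lookup-injective (x ∷ xs) (_ ∷ u)  {suc i} {suc j} eq = cong suc (lookup-injective xs u eq)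

    lookup-Linked : ∀ (xs : List V) → Linked _~_ xs →
                    ∀ i j → suc (toℕ i) ≡ toℕ j → lookup xs i ~ lookup xs j
    lookup-Linked (x ∷ y ∷ xs) (e ∷ _)  zero    (suc zero) _  = e
    lookup-Linked (x ∷ y ∷ xs) (_ ∷ es) (suc i) (suc j)    eq =
      lookup-Linked (y ∷ xs) es i j (suc-injective eq)

    lookup-Linked-last : ∀ (xs : List V) {z} → Linked _~_ (xs ∷ʳ z) →
                         ∀ i → suc (toℕ i) ≡ length xs → lookup xs i ~ z
    lookup-Linked-last (x ∷ [])     (e ∷ [-]) zero    _  = e
    lookup-Linked-last (x ∷ y ∷ xs) (_ ∷ es) (suc i) eq =
      lookup-Linked-last (y ∷ xs) es i (suc-injective eq)

  closedPath⇒Cycle : ∀ x xs → 2 ≤ length xs → Unique (x ∷ xs) → Linked _~_ (x ∷ xs ∷ʳ x) →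
                     Cycle G (suc (length xs))
  closedPath⇒Cycle x xs 2≤ u es = record
    { three≤L = s≤s 2≤
    ; vtx     = lookup (x ∷ xs)
    ; inj     = lookup-injective (x ∷ xs) u
    ; edges   = edge
    }
    where
    edge : ∀ i j → Consecutive (suc (length xs)) i j → lookup (x ∷ xs) i ~ lookup (x ∷ xs) j
    edge i j       (inj₁ i+1≡j)       = lookup-Linked (x ∷ xs) (Linked-++⁻ˡ (x ∷ xs) es) i j i+1≡j
    edge i zero    (inj₂ (i+1≡L , _)) = lookup-Linked-last (x ∷ xs) es i i+1≡L
    edge i (suc j) (inj₂ (_ , ()))

  edge-SimplePath : ∀ {a b} → a ~ b → SimplePath (a ∷ [ b ])
  edge-SimplePath a~b = ((λ { refl → ~-irrefl a~b }) ∷ []) ∷ [] ∷ [] , a~b ∷ [-]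

  SimplePath-tail : ∀ {x xs} → SimplePath (x ∷ xs) → SimplePath xs
  SimplePath-tail (_ ∷ u , es) = u , Linked.tail es

  SimplePath-∷ʳ : ∀ xs {y ys} → SimplePath (xs ++ y ∷ ys) → SimplePath (xs ∷ʳ y)
  SimplePath-∷ʳ xs (u , es) = Unique-∷ʳ xs u , Linked-∷ʳ xs es

  module Girth (g : ℕ) (girth≤ : ∀ L → Cycle G L → g ≤ L) where

    girth≤-chord : ∀ {u p₁ w} ps → SimplePath (u ∷ p₁ ∷ ps) → u ~ w → w ∈ ps →
                   g ≤ length (u ∷ p₁ ∷ ps)
    girth≤-chord {u} {p₁} {w} ps (u′ , es) u~w w∈ps with A , R , refl ← ∈-∃++ w∈ps =
      ≤-trans (girth≤ _ cycle) (s≤s (s≤s (length-++-∷ A)))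
      where
      cycle : Cycle G (suc (length (u ∷ p₁ ∷ A)))
      cycle = closedPath⇒Cycle w (u ∷ p₁ ∷ A) (s≤s (s≤s z≤n))
                (Unique-∷-++ (u ∷ p₁ ∷ A) u′) (~-sym u~w ∷ Linked-∷ʳ (u ∷ p₁ ∷ A) es)

    girth≤-two-paths : ∀ {x y} F B → SimplePath (x ∷ F ∷ʳ y) → SimplePath (x ∷ B ∷ʳ y) →
                       Disjoint B F → 2 ≤ length B + suc (length F) →
                       g ≤ suc (length B + suc (length F))
    girth≤-two-paths {x} {y} F B (x∉F∷ʳy ∷ uF∷ʳy , esF) (x∉B∷ʳy ∷ uB∷ʳy , esB) B#F 2≤ =
      subst (g ≤_) (cong suc (length-ʳ++ B)) (girth≤ _ cycle)
      where
      uF : Unique F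
      uF = proj₁ (Unique-++⁻ F uF∷ʳy)
      uB : Unique B
      uB = proj₁ (Unique-++⁻ B uB∷ʳy)
      F#y : Disjoint F [ y ]
      F#y = proj₂ (proj₂ (Unique-++⁻ F uF∷ʳy))
      B#y : Disjoint B [ y ]
      B#y = proj₂ (proj₂ (Unique-++⁻ B uB∷ʳy))
      x∉F : All (x ≢_) F
      x∉F = All.++⁻ˡ F x∉F∷ʳy
      x≢y : x ≢ y
      x≢y = All.lookup x∉F∷ʳy (∈-++⁺ʳ F (here refl))

      y∉C : All (y ≢_) (B ʳ++ x ∷ F)
      y∉C = All.tabulate λ {v} v∈C y≡v → y≢ (∈-ʳ++⁻ B v∈C) y≡v
        where
        y≢ : ∀ {v} → v ∈ B ⊎ v ∈ x ∷ F → y ≢ v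
        y≢ (inj₁ v∈B)         refl = B#y (v∈B , here refl)
        y≢ (inj₂ (here refl)) refl = x≢y refl
        y≢ (inj₂ (there v∈F)) refl = F#y (v∈F , here refl)

      B#x∷F : Disjoint B (x ∷ F)
      B#x∷F (v∈B , here refl)  = All.lookup (All.++⁻ˡ B x∉B∷ʳy) v∈B refl
      B#x∷F (v∈B , there v∈F) = B#F (v∈B , v∈F)

      -- The cycle runs from y back along B to x, then along F to y.
      linked : Linked _~_ (y ∷ (B ʳ++ x ∷ F) ∷ʳ y)
      linked = subst (Linked _~_) (trans (++-ʳ++ B) (cong (y ∷_) (ʳ++-++ B)))
                 (Linked-ʳ++ ~-sym (B ∷ʳ y) esB esF)

      cycle : Cycle G (suc (length (B ʳ++ x ∷ F)))
      cycle = closedPath⇒Cycle y (B ʳ++ x ∷ F) (subst (2 ≤_) (sym (length-ʳ++ B)) 2≤)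
                (y∉C ∷ Unique-ʳ++ B uB (x∉F ∷ uF) B#x∷F)
                linked

    girth≤-diverging-paths : ∀ {x a} X Y → SimplePath (x ∷ X ∷ʳ a) → SimplePath (x ∷ Y ∷ʳ a) →
                             headOr a (X ∷ʳ a) ≢ headOr a (Y ∷ʳ a) →
                             g ≤ suc (length X) + suc (length Y)
    girth≤-diverging-paths {x} {a} X Y P Q differ
      with split-at-first {P = _∈ Y ∷ʳ a} (_∈? Y ∷ʳ a) (Any.++⁺ʳ X (here (∈-++⁺ʳ Y (here refl))))
    ... | F , y , R , X≡ , F∉Y , y∈Y with ∈-∃++ y∈Y
    ... | B , R′ , Y≡ =
      ≤-trans (girth≤-two-paths F B (prefix X≡ P) (prefix Y≡ Q) B#F
                 (distinct-heads⇒nonempty F B λ same → differ (trans (cong (headOr a) X≡)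
                                                             (trans same (cong (headOr a) (sym Y≡))))))
              (subst (_≤ suc (length X) + suc (length Y)) (+-comm (suc (length F)) (suc (length B)))
                 (+-mono-≤ (s≤s (length-prefix X F X≡)) (s≤s (length-prefix Y B Y≡))))
      where
      prefix : ∀ {Z C z S} → Z ∷ʳ a ≡ C ++ z ∷ S → SimplePath (x ∷ Z ∷ʳ a) → SimplePath (x ∷ C ∷ʳ z)
      prefix {C = C} eq p = SimplePath-∷ʳ (x ∷ C) (subst (λ t → SimplePath (x ∷ t)) eq p)

      B#F : Disjoint B F
      B#F (v∈B , v∈F) = All.lookup F∉Y v∈F (subst (_ ∈_) (sym Y≡) (∈-++⁺ˡ v∈B))

    girth≤-distinct-paths : ∀ X Y {a} → SimplePath (X ∷ʳ a) → SimplePath (Y ∷ʳ a) →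
                            headOr a (X ∷ʳ a) ≡ headOr a (Y ∷ʳ a) → X ≢ Y →
                            g ≤ length X + length Y
    girth≤-distinct-paths []      []      _              _              _    X≢Y = ⊥-elim (X≢Y refl)
    girth≤-distinct-paths []      (y ∷ Y) _              (y∉ ∷ _ , _)   refl _   =
      ⊥-elim (All.lookup y∉ (∈-++⁺ʳ Y (here refl)) refl)
    girth≤-distinct-paths (x ∷ X) []      (x∉ ∷ _ , _)   _              refl _   =
      ⊥-elim (All.lookup x∉ (∈-++⁺ʳ X (here refl)) refl)
    girth≤-distinct-paths (x ∷ X) (y ∷ Y) {a} P Q refl X≢Y
      with headOr a (X ∷ʳ a) Fin.≟ headOr a (Y ∷ʳ a)
    ... | yes same = ≤-trans (girth≤-distinct-paths X Y (SimplePath-tail P) (SimplePath-tail Q) same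
                                (X≢Y ∘ cong (x ∷_)))
                             (+-mono-≤ (n≤1+n _) (n≤1+n _))
    ... | no differ = girth≤-diverging-paths X Y P Q differ

-- Moore trees

module Branches {n : ℕ} (G : Graph n) where
  open Paths G
  open DecMembership (Fin._≟_ {n}) using (_∈?_)

  -- Paths are stored newest vertex first: layer j p₀ lists the simple paths obtained from
  -- p₀ by adding j vertices at its head, and tree j p₀ the layers 0, …, j.

  neighbours : V → List V
  neighbours u = filter (u ~?_) (allFin n)

  Unique-neighbours : ∀ u → Unique (neighbours u)
  Unique-neighbours u = Unique.filter⁺ _ (Unique.allFin⁺ n)

  ∈-neighbours⁻ : ∀ {u w} → w ∈ neighbours u → u ~ w
  ∈-neighbours⁻ {u} w∈ = proj₂ (∈-filter⁻ (u ~?_) {xs = allFin n} w∈)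

  newNeighbours : V → List V → List V
  newNeighbours u p = filter (λ w → ¬? (w ∈? p)) (neighbours u)

  extensions : List V → List (List V)
  extensions []      = []
  extensions (u ∷ p) = map (_∷ u ∷ p) (newNeighbours u (u ∷ p))

  length-extensions-∷ : ∀ u p → length (extensions (u ∷ p)) ≡ length (newNeighbours u (u ∷ p))
  length-extensions-∷ u p = length-map (_∷ u ∷ p) (newNeighbours u (u ∷ p))

  layer : ℕ → List V → List (List V)
  layer zero    p₀ = [ p₀ ]
  layer (suc j) p₀ = concatMap extensions (layer j p₀)

  tree : ℕ → List V → List (List V)
  tree zero    p₀ = layer zero p₀
  tree (suc j) p₀ = tree j p₀ ++ layer (suc j) p₀

  ∈-extensions⁻ : ∀ {u p q} → q ∈ extensions (u ∷ p) →
                  ∃ λ w → q ≡ w ∷ u ∷ p × u ~ w × w ∉ u ∷ p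
  ∈-extensions⁻ {u} {p} q∈ with w , w∈ , refl ← ∈-map⁻ (_∷ u ∷ p) q∈ =
    let w∈N , w∉ = ∈-filter⁻ (λ w → ¬? (w ∈? u ∷ p)) {xs = neighbours u} w∈
    in w , refl , ∈-neighbours⁻ w∈N , w∉

  extensions-∷ : ∀ p {q} → q ∈ extensions p → ∃ λ w → q ≡ w ∷ p
  extensions-∷ (u ∷ p) q∈ with w , q≡ , _ ← ∈-extensions⁻ q∈ = w , q≡

  extensions-SimplePath : ∀ p {q} → SimplePath p → q ∈ extensions p → SimplePath q
  extensions-SimplePath (u ∷ p) (up , es) q∈ with w , refl , u~w , w∉ ← ∈-extensions⁻ q∈ =
    All.¬Any⇒All¬ _ w∉ ∷ up , ~-sym u~w ∷ es

  ∈-layer⁻ : ∀ j {p₀ p} → p ∈ layer j p₀ → ∃ λ X → p ≡ X ++ p₀ × length X ≡ j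
  ∈-layer⁻ zero    (here refl) = [] , refl , refl
  ∈-layer⁻ (suc j) {p₀} p∈
    with p′ , p′∈ , p∈ext ← find (∈-concatMap⁻ extensions {xs = layer j p₀} p∈)
    with X , refl , refl ← ∈-layer⁻ j p′∈
    with w , refl ← extensions-∷ p′ p∈ext = w ∷ X , refl , refl

  layer-SimplePath : ∀ j {p₀ p} → SimplePath p₀ → p ∈ layer j p₀ → SimplePath p
  layer-SimplePath zero    P₀ (here refl) = P₀
  layer-SimplePath (suc j) {p₀} P₀ p∈
    with p′ , p′∈ , p∈ext ← find (∈-concatMap⁻ extensions {xs = layer j p₀} p∈) =
    extensions-SimplePath p′ (layer-SimplePath j P₀ p′∈) p∈ext

  ∈-tree⁻ : ∀ j {p₀ p} → p ∈ tree j p₀ → ∃ λ i → i ≤ j × p ∈ layer i p₀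
  ∈-tree⁻ zero              p∈ = zero , z≤n , p∈
  ∈-tree⁻ (suc j) {p₀} p∈ with ∈-++⁻ (tree j p₀) p∈
  ... | inj₁ p∈tree with i , i≤j , p∈layer ← ∈-tree⁻ j p∈tree = i , m≤n⇒m≤1+n i≤j , p∈layer
  ... | inj₂ p∈layer = suc j , ≤-refl , p∈layer

  Unique-layer : ∀ j {p₀} → Unique (layer j p₀)
  Unique-layer zero    = [] ∷ []
  Unique-layer (suc j) = Unique-concatMap⁺ extensions (Unique-layer j) Unique-extensions same-parent
    where
    Unique-extensions : ∀ p → Unique (extensions p)
    Unique-extensions []      = []
    Unique-extensions (u ∷ p) = Unique.map⁺ ∷-injectiveˡ (Unique.filter⁺ _ (Unique-neighbours u))
    same-parent : ∀ {p p′ q} → q ∈ extensions p → q ∈ extensions p′ → p ≡ p′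
    same-parent {p} {p′} q∈ q∈′
      with _ , refl ← extensions-∷ p q∈ | _ , eq ← extensions-∷ p′ q∈′ = ∷-injectiveʳ eq

  Unique-tree : ∀ j {a s} → Unique (tree j (a ∷ s))
  Unique-tree zero    = Unique-layer zero
  Unique-tree (suc j) {a} {s} = Unique.++⁺ (Unique-tree j) (Unique-layer (suc j)) different-lengths
    where
    different-lengths : Disjoint (tree j (a ∷ s)) (layer (suc j) (a ∷ s))
    different-lengths (p∈tree , p∈layer)
      with i , i≤j , p∈layerᵢ ← ∈-tree⁻ j p∈tree
      with X , refl , refl ← ∈-layer⁻ i p∈layerᵢ
      with Y , eq , |Y|≡1+j ← ∈-layer⁻ (suc j) p∈layer =
      <⇒≢ (s≤s i≤j) (trans (+-cancelʳ-≡ _ _ _ |X++as|≡|Y++as|) |Y|≡1+j)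
      where
      |X++as|≡|Y++as| : length X + length (a ∷ s) ≡ length Y + length (a ∷ s)
      |X++as|≡|Y++as| = trans (sym (length-++ X)) (trans (cong length eq) (length-++ Y))

module MooreTree {n : ℕ} (G : Graph n) (g : ℕ) (girth≤ : ∀ L → Cycle G L → g ≤ L)
                 (δ : ℕ) (δ≤deg : ∀ v → δ ≤ degree G v) where
  open Paths G
  open Girth g girth≤
  open Branches G
  open DecMembership (Fin._≟_ {n}) using (_∈?_)

  length-extensions-root : ∀ u → δ ≤ length (extensions [ u ])
  length-extensions-root u = begin
    δ                                                ≤⟨ δ≤deg u ⟩
    length (neighbours u)                            ≡⟨ cong length (filter-all _ (All.tabulate not-root)) ⟨
    length (newNeighbours u [ u ])                   ≡⟨ length-extensions-∷ u [] ⟨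
    length (extensions [ u ])                        ∎
    where
    open ≤-Reasoning
    not-root : ∀ {w} → w ∈ neighbours u → w ∉ [ u ]
    not-root w∈N (here refl) = ~-irrefl (∈-neighbours⁻ w∈N)

  length-extensions : ∀ p → 2 ≤ length p → SimplePath p → length p < g →
                      δ ∸ 1 ≤ length (extensions p)
  length-extensions (u ∷ []) (s≤s ())
  length-extensions (u ∷ p₁ ∷ ps) _ P |p|<g = begin
    δ ∸ 1                          ≤⟨ ∸-monoˡ-≤ 1 (≤-trans (δ≤deg u) deg≤1+new) ⟩
    length (newNeighbours u p)     ≡⟨ length-extensions-∷ u (p₁ ∷ ps) ⟨
    length (extensions p)          ∎
    where
    open ≤-Reasoning
    p : List V
    p = u ∷ p₁ ∷ ps
    off-path : ∀ {w} → w ∈ neighbours u → w ∉ p ⊎ w ≡ p₁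
    off-path {w} w∈N with w ∈? p
    ... | no w∉p                   = inj₁ w∉p
    ... | yes (here refl)          = ⊥-elim (~-irrefl (∈-neighbours⁻ w∈N))
    ... | yes (there (here w≡p₁))  = inj₂ w≡p₁
    ... | yes (there (there w∈ps)) = ⊥-elim (<⇒≱ |p|<g (girth≤-chord ps P (∈-neighbours⁻ w∈N) w∈ps))
    deg≤1+new : degree G u ≤ suc (length (newNeighbours u p))
    deg≤1+new = length-filter-all-but-one _ (neighbours u) (Unique-neighbours u) off-path

  length-layer-suc : ∀ j {a s} → SimplePath (a ∷ s) →
                     2 ≤ length (a ∷ s) + j → length (a ∷ s) + j < g →
                     (δ ∸ 1) * length (layer j (a ∷ s)) ≤ length (layer (suc j) (a ∷ s))
  length-layer-suc j {a} {s} P₀ 2≤ <g = length-concatMap-≥ extensions (δ ∸ 1) (layer j (a ∷ s)) grow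
    where
    grow : ∀ {p} → p ∈ layer j (a ∷ s) → δ ∸ 1 ≤ length (extensions p)
    grow {p} p∈ with X , p≡ , |X|≡j ← ∈-layer⁻ j p∈ =
      length-extensions p (subst (2 ≤_) (sym |p|) 2≤) (layer-SimplePath j P₀ p∈)
                          (subst (_< g) (sym |p|) <g)
      where
      |p| : length p ≡ length (a ∷ s) + j
      |p| = begin
        length p                    ≡⟨ cong length p≡ ⟩
        length (X ++ a ∷ s)         ≡⟨ length-++ X ⟩
        length X + length (a ∷ s)   ≡⟨ +-comm (length X) _ ⟩
        length (a ∷ s) + length X   ≡⟨ cong (length (a ∷ s) +_) |X|≡j ⟩
        length (a ∷ s) + j          ∎
        where open ≡-Reasoning

  length-layer-vertex : ∀ {a} i → suc i < g → δ * (δ ∸ 1) ^ i ≤ length (layer (suc i) [ a ])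
  length-layer-vertex {a} zero _ = begin
    δ * 1                       ≡⟨ *-identityʳ δ ⟩
    δ                           ≤⟨ length-extensions-root a ⟩
    length (extensions [ a ])   ≡⟨ cong length (++-identityʳ (extensions [ a ])) ⟨
    length (layer 1 [ a ])      ∎
    where open ≤-Reasoning
  length-layer-vertex {a} (suc i) <g = begin
    δ * ((δ ∸ 1) * (δ ∸ 1) ^ i)
      ≡⟨ x∙yz≈y∙xz δ (δ ∸ 1) _ ⟩
    (δ ∸ 1) * (δ * (δ ∸ 1) ^ i)
      ≤⟨ *-monoʳ-≤ (δ ∸ 1) (length-layer-vertex i (<-trans (n<1+n _) <g)) ⟩
    (δ ∸ 1) * length (layer (suc i) [ a ])
      ≤⟨ length-layer-suc (suc i) vertex-SimplePath (s≤s (s≤s z≤n)) <g ⟩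
    length (layer (suc (suc i)) [ a ])
      ∎
    where open ≤-Reasoning

  length-layer-edge : ∀ {a b} → a ~ b → ∀ j → suc (suc j) ≤ g →
                      (δ ∸ 1) ^ j ≤ length (layer j (a ∷ [ b ]))
  length-layer-edge a~b zero    _  = ≤-refl
  length-layer-edge {a} {b} a~b (suc j) <g = begin
    (δ ∸ 1) * (δ ∸ 1) ^ j
      ≤⟨ *-monoʳ-≤ (δ ∸ 1) (length-layer-edge a~b j (<⇒≤ <g)) ⟩
    (δ ∸ 1) * length (layer j (a ∷ [ b ]))
      ≤⟨ length-layer-suc j (edge-SimplePath a~b) (s≤s (s≤s z≤n)) <g ⟩
    length (layer (suc j) (a ∷ [ b ]))
      ∎
    where open ≤-Reasoning

  length-tree : ∀ j {p₀} (f : ℕ → ℕ) → (∀ {i} → i < j → f i ≤ length (layer (suc i) p₀)) →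
                suc (sumBelow j f) ≤ length (tree j p₀)
  length-tree zero         f _ = ≤-refl
  length-tree (suc j) {p₀} f h = begin
    suc (sumBelow j f) + f j
      ≤⟨ +-mono-≤ (length-tree j f (h ∘ m<n⇒m<1+n)) (h ≤-refl) ⟩
    length (tree j p₀) + length (layer (suc j) p₀)
      ≡⟨ length-++ (tree j p₀) ⟨
    length (tree (suc j) p₀)
      ∎
    where open ≤-Reasoning

  module _ (k : ℕ) where

    heads : V → List V → List V
    heads a s = map (headOr a) (tree k (a ∷ s))

    length-heads : ∀ a s → length (heads a s) ≡ length (tree k (a ∷ s))
    length-heads a s = length-map (headOr a) (tree k (a ∷ s))

    ∈-tree-stem : ∀ {a s p} → p ∈ tree k (a ∷ s) → ∃ λ X → p ≡ X ++ a ∷ s × length X ≤ k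
    ∈-tree-stem p∈
      with i , i≤k , p∈layer ← ∈-tree⁻ k p∈
      with X , p≡ , refl ← ∈-layer⁻ i p∈layer = X , p≡ , i≤k

    tree-SimplePath : ∀ {p₀ p} → SimplePath p₀ → p ∈ tree k p₀ → SimplePath p
    tree-SimplePath P₀ p∈ with i , _ , p∈layer ← ∈-tree⁻ k p∈ = layer-SimplePath i P₀ p∈layer

    heads-walk : ∀ {a s w} → SimplePath (a ∷ s) → w ∈ heads a s → ∃ λ l → l ≤ k × Walk G w a l
    heads-walk {a} P₀ w∈
      with p , p∈ , refl ← ∈-map⁻ (headOr a) w∈
      with X , refl , |X|≤k ← ∈-tree-stem p∈ =
      length X , |X|≤k , subst (λ w → Walk G w a (length X)) (headOr-++-∷ X)
                           (Linked⇒Walk X (proj₂ (SimplePath-∷ʳ X (tree-SimplePath P₀ p∈))))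

    Unique-heads : ∀ {a s} → SimplePath (a ∷ s) → k + k < g → Unique (heads a s)
    Unique-heads {a} {s} P₀ 2k<g = Unique-map⁺ (headOr a) same-head (Unique-tree k)
      where
      same-head : ∀ {p q} → p ∈ tree k (a ∷ s) → q ∈ tree k (a ∷ s) →
                  headOr a p ≡ headOr a q → p ≡ q
      same-head p∈ q∈ heads≡
        with X , refl , |X|≤k ← ∈-tree-stem p∈
        with Y , refl , |Y|≤k ← ∈-tree-stem q∈
        with ≡-dec Fin._≟_ X Y
      ... | yes refl = refl
      ... | no X≢Y   = contradiction (≤-trans girth≤2k (+-mono-≤ |X|≤k |Y|≤k)) (<⇒≱ 2k<g)
        where
        girth≤2k : g ≤ length X + length Y
        girth≤2k = girth≤-distinct-paths X Y
          (SimplePath-∷ʳ X (tree-SimplePath P₀ p∈)) (SimplePath-∷ʳ Y (tree-SimplePath P₀ q∈))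
          (trans (headOr-++-∷ X) (trans heads≡ (headOr-++-∷ Y))) X≢Y

    heads-edge-disjoint : ∀ {a b} → a ~ b → suc (k + k) < g → Disjoint (heads a [ b ]) (heads b [ a ])
    heads-edge-disjoint {a} {b} a~b 2k+1<g (w∈ , w∈′)
      with p , p∈ , refl   ← ∈-map⁻ (headOr a) w∈
      with q , q∈ , heads≡ ← ∈-map⁻ (headOr b) w∈′
      with X , refl , |X|≤k ← ∈-tree-stem p∈
      with Y , refl , |Y|≤k ← ∈-tree-stem q∈ =
      contradiction (≤-trans girth≤2k+1 bound) (<⇒≱ 2k+1<g)
      where
      P : SimplePath (X ++ a ∷ [ b ])
      P = tree-SimplePath (edge-SimplePath a~b) p∈
      Q : SimplePath (Y ++ b ∷ [ a ])
      Q = tree-SimplePath (edge-SimplePath (~-sym a~b)) q∈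
      a∉Y : a ∉ Y
      a∉Y a∈Y = proj₂ (proj₂ (Unique-++⁻ Y (proj₁ Q))) (a∈Y , there (here refl))
      girth≤2k+1 : g ≤ length (X ∷ʳ a) + length Y
      girth≤2k+1 = girth≤-distinct-paths (X ∷ʳ a) Y
        (subst SimplePath (sym (∷ʳ-++ X a [ b ])) P) (SimplePath-∷ʳ Y Q)
        (trans (cong (headOr b) (∷ʳ-++ X a [ b ]))
               (trans (headOr-++-∷ X) (trans heads≡ (headOr-++-∷ Y))))
        (λ X∷ʳa≡Y → a∉Y (subst (a ∈_) X∷ʳa≡Y (∈-++⁺ʳ X (here refl))))
      bound : length (X ∷ʳ a) + length Y ≤ suc (k + k)
      bound = subst (_≤ suc (k + k)) (cong (_+ length Y) (sym (length-∷ʳ X)))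
                    (s≤s (+-mono-≤ |X|≤k |Y|≤k))

-- Arcs of a cycle

minimal-witness : ∀ {P : Pred ℕ 0ℓ} → Decidable P → ∀ {N} → P N →
                  ∃ λ m → P m × m ≤ N × (∀ {i} → i < m → ¬ P i)
minimal-witness {P} P? {N} = search 0 N (λ ())
  where
  extend : ∀ {i} → (∀ {j} → j < i → ¬ P j) → ¬ P i → ∀ {j} → j < suc i → ¬ P j
  extend below ¬pᵢ j<1+i with m<1+n⇒m<n∨m≡n j<1+i
  ... | inj₁ j<i  = below j<i
  ... | inj₂ refl = ¬pᵢ

  search : ∀ i d → (∀ {j} → j < i → ¬ P j) → P (i + d) →
           ∃ λ m → P m × m ≤ i + d × (∀ {j} → j < m → ¬ P j)
  search i d       below p with P? i
  ... | yes pᵢ = i , pᵢ , m≤m+n i d , below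
  search i zero    below p | no ¬pᵢ = contradiction (subst P (+-identityʳ i) p) ¬pᵢ
  search i (suc d) below p | no ¬pᵢ
    with m , pₘ , m≤ , minimal ← search (suc i) d (extend below ¬pᵢ) (subst P (+-suc i d) p) =
    m , pₘ , subst (m ≤_) (sym (+-suc i d)) m≤ , minimal

module Rotation (m : ℕ) where

  q : ℕ
  q = suc m

  rotate : Fin q → ℕ → Fin q
  rotate x t = (toℕ x + t) mod q

  toℕ-rotate : ∀ x t → toℕ (rotate x t) ≡ (toℕ x + t) % q
  toℕ-rotate x t = Fin.toℕ-fromℕ< (m%n<n (toℕ x + t) q)

  rotate-+ : ∀ x a b → rotate (rotate x a) b ≡ rotate x (a + b)
  rotate-+ x a b = Fin.toℕ-injective (begin
    toℕ (rotate (rotate x a) b)      ≡⟨ toℕ-rotate (rotate x a) b ⟩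
    (toℕ (rotate x a) + b) % q       ≡⟨ cong (λ z → (z + b) % q) (toℕ-rotate x a) ⟩
    ((toℕ x + a) % q + b) % q        ≡⟨ %-distribˡ-+ ((toℕ x + a) % q) b q ⟩
    ((toℕ x + a) % q % q + b % q) % q ≡⟨ cong (λ z → (z + b % q) % q) (m%n%n≡m%n (toℕ x + a) q) ⟩
    ((toℕ x + a) % q + b % q) % q    ≡⟨ %-distribˡ-+ (toℕ x + a) b q ⟨
    (toℕ x + a + b) % q              ≡⟨ cong (_% q) (+-assoc (toℕ x) a b) ⟩
    (toℕ x + (a + b)) % q            ≡⟨ toℕ-rotate x (a + b) ⟨
    toℕ (rotate x (a + b))           ∎)
    where open ≡-Reasoning

  rotate-q : ∀ x → rotate x q ≡ x
  rotate-q x = Fin.toℕ-injective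
    (trans (toℕ-rotate x q) (trans ([m+n]%n≡m%n (toℕ x) q) (m<n⇒m%n≡m (Fin.toℕ<n x))))

  rotate-back : ∀ x {t} → t ≤ q → rotate (rotate x (q ∸ t)) t ≡ x
  rotate-back x {t} t≤q =
    trans (rotate-+ x (q ∸ t) t) (trans (cong (rotate x) (m∸n+n≡m t≤q)) (rotate-q x))

  rotate-1-injective : ∀ {x y} → rotate x 1 ≡ rotate y 1 → x ≡ y
  rotate-1-injective {x} {y} eq = begin
    x                        ≡⟨ rotate-q x ⟨
    rotate x q               ≡⟨ rotate-+ x 1 m ⟨
    rotate (rotate x 1) m    ≡⟨ cong (λ z → rotate z m) eq ⟩
    rotate (rotate y 1) m    ≡⟨ rotate-+ y 1 m ⟩
    rotate y q               ≡⟨ rotate-q y ⟩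
    y                        ∎
    where open ≡-Reasoning

  rotate-reaches : ∀ x y → ∃ λ e → e < q × rotate x e ≡ y
  rotate-reaches x y = toℕ z , Fin.toℕ<n z ,
    trans (cong (_mod q) (+-comm (toℕ x) (toℕ z))) (rotate-back y (<⇒≤ (Fin.toℕ<n x)))
    where
    z : Fin q
    z = rotate y (q ∸ toℕ x)

  rotate-1-Consecutive : ∀ x → Consecutive q x (rotate x 1)
  rotate-1-Consecutive x with suc (toℕ x) <? q
  ... | yes 1+x<q = inj₁ (sym (trans (toℕ-rotate x 1)
                      (trans (cong (_% q) (+-comm (toℕ x) 1)) (m<n⇒m%n≡m 1+x<q))))
  ... | no 1+x≮q  = inj₂ (1+x≡q , trans (toℕ-rotate x 1)
                      (trans (cong (_% q) (trans (+-comm (toℕ x) 1) 1+x≡q)) (n%n≡0 q)))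
    where
    1+x≡q : suc (toℕ x) ≡ q
    1+x≡q = ≤-antisym (Fin.toℕ<n x) (≮⇒≥ 1+x≮q)

  cycDist-rotate : ∀ x {t} → t < q → cycDist q x (rotate x t) ≡ t ⊓ (q ∸ t)
  cycDist-rotate x {t} t<q with toℕ x + t <? q
  ... | yes x+t<q = cong (λ d → d ⊓ (q ∸ d)) (begin
    ∣ toℕ x - toℕ (rotate x t) ∣   ≡⟨ cong (∣ toℕ x -_∣) (toℕ-rotate x t) ⟩
    ∣ toℕ x - (toℕ x + t) % q ∣    ≡⟨ cong (∣ toℕ x -_∣) (m<n⇒m%n≡m x+t<q) ⟩
    ∣ toℕ x - toℕ x + t ∣          ≡⟨ ∣m-m+n∣≡n (toℕ x) t ⟩
    t                             ∎)
    where open ≡-Reasoning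
  ... | no x+t≮q = begin
    ∣ X - y ∣ ⊓ (q ∸ ∣ X - y ∣)   ≡⟨ cong (λ d → d ⊓ (q ∸ d)) ∣X-y∣≡q∸t ⟩
    (q ∸ t) ⊓ (q ∸ (q ∸ t))       ≡⟨ cong ((q ∸ t) ⊓_) (m∸[m∸n]≡n (<⇒≤ t<q)) ⟩
    (q ∸ t) ⊓ t                   ≡⟨ ⊓-comm (q ∸ t) t ⟩
    t ⊓ (q ∸ t)                   ∎
    where
    open ≡-Reasoning
    X y d : ℕ
    X = toℕ x
    y = toℕ (rotate x t)
    d = X + t ∸ q
    q≤X+t : q ≤ X + t
    q≤X+t = ≮⇒≥ x+t≮q
    X+t≡d+q : X + t ≡ d + q
    X+t≡d+q = sym (m∸n+n≡m q≤X+t)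
    d+q<q+q : d + q < q + q
    d+q<q+q = subst (_< q + q) X+t≡d+q (+-mono-< (Fin.toℕ<n x) t<q)
    y≡d : y ≡ d
    y≡d = begin
      y            ≡⟨ toℕ-rotate x t ⟩
      (X + t) % q  ≡⟨ cong (_% q) X+t≡d+q ⟩
      (d + q) % q  ≡⟨ [m+n]%n≡m%n d q ⟩
      d % q        ≡⟨ m<n⇒m%n≡m (+-cancelʳ-< q d q d+q<q+q) ⟩
      d            ∎
    ∣X-y∣≡q∸t : ∣ X - y ∣ ≡ q ∸ t
    ∣X-y∣≡q∸t = begin
      ∣ X - y ∣              ≡⟨ cong (∣ X -_∣) y≡d ⟩
      ∣ X - d ∣              ≡⟨ ∣m+n-m+o∣≡∣n-o∣ t X d ⟨
      ∣ t + X - t + d ∣      ≡⟨ cong₂ ∣_-_∣ (+-comm t X) (+-comm t d) ⟩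
      ∣ X + t - d + t ∣      ≡⟨ cong (λ z → ∣ z - d + t ∣) X+t≡d+q ⟩
      ∣ d + q - d + t ∣      ≡⟨ ∣m+n-m+o∣≡∣n-o∣ d q t ⟩
      ∣ q - t ∣              ≡⟨ m≤n⇒∣n-m∣≡n∸m (<⇒≤ t<q) ⟩
      q ∸ t                  ∎

  cycDist-rotate-≤ : ∀ x {t D} → t < q → cycDist q x (rotate x t) ≤ D → t ≤ D ⊎ q ≤ t + D
  cycDist-rotate-≤ x {t} {D} t<q ≤D with ≤-total t (q ∸ t)
  ... | inj₁ t≤q∸t = inj₁ (subst (_≤ D) (trans (cycDist-rotate x t<q) (m≤n⇒m⊓n≡m t≤q∸t)) ≤D)
  ... | inj₂ q∸t≤t = inj₂ (begin
    q             ≡⟨ m+[n∸m]≡n (<⇒≤ t<q) ⟨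
    t + (q ∸ t)   ≤⟨ +-monoʳ-≤ t q∸t≤D ⟩
    t + D         ∎)
    where
    open ≤-Reasoning
    q∸t≤D : q ∸ t ≤ D
    q∸t≤D = subst (_≤ D) (trans (cycDist-rotate x t<q) (m≥n⇒m⊓n≡n q∸t≤t)) ≤D

  arc : Fin q → ℕ → List (Fin q)
  arc s l = map (rotate s) (upTo l)

  ∑-⟦⟧-≤-arc : ∀ {J : Pred (Fin q) 0ℓ} (J? : Decidable J) s l →
               (∀ {j} → J j → ∃ λ t → t < l × rotate s t ≡ j) → ∑[ i < q ] ⟦ J? i ⟧ ≤ l
  ∑-⟦⟧-≤-arc {J} J? s l near =
    subst (∑[ i < q ] ⟦ J? i ⟧ ≤_) |arc|≡l (∑-⟦⟧-≤-length J? (arc s l) in-arc)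
    where
    |arc|≡l : length (arc s l) ≡ l
    |arc|≡l = trans (length-map (rotate s) (upTo l)) (length-upTo l)
    in-arc : ∀ {j} → J j → j ∈ arc s l
    in-arc Jj with t , t<l , refl ← near Jj = ∈-map⁺ (rotate s) (∈-upTo⁺ t<l)

  module _ (D : ℕ) (3D<q : D + D + D < q) {J : Pred (Fin q) 0ℓ} (J? : Decidable J)
           (close : ∀ {i j} → J i → J j → cycDist q i j ≤ D) where

    private
      D≤q : D ≤ q
      D≤q = ≤-trans (≤-trans (m≤m+n D D) (m≤m+n (D + D) D)) (<⇒≤ 3D<q)

      start : Fin q → Fin q
      start i₀ = rotate i₀ (q ∸ D)

      start+D : ∀ i₀ → rotate (start i₀) D ≡ i₀
      start+D i₀ = rotate-back i₀ D≤q

      start+e : ∀ i₀ {e} → D ≤ e → rotate (start i₀) e ≡ rotate i₀ (e ∸ D)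
      start+e i₀ {e} D≤e = begin
        rotate (start i₀) e                    ≡⟨ cong (rotate (start i₀)) (m+[n∸m]≡n D≤e) ⟨
        rotate (start i₀) (D + (e ∸ D))        ≡⟨ rotate-+ (start i₀) D (e ∸ D) ⟨
        rotate (rotate (start i₀) D) (e ∸ D)   ≡⟨ cong (λ z → rotate z (e ∸ D)) (start+D i₀) ⟩
        rotate i₀ (e ∸ D)                      ∎
        where open ≡-Reasoning

      offset≤2D : ∀ {i₀ e} → J i₀ → e < q → J (rotate (start i₀) e) → e ≤ D + D
      offset≤2D {i₀} {e} Ji₀ e<q Je with ≤-total e D
      ... | inj₁ e≤D = ≤-trans e≤D (m≤m+n D D)
      ... | inj₂ D≤e with cycDist-rotate-≤ i₀ (≤-<-trans (m∸n≤m e D) e<q)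
                            (subst (λ z → cycDist q i₀ z ≤ D) (start+e i₀ D≤e) (close Ji₀ Je))
      ...   | inj₁ e∸D≤D   = subst (_≤ D + D) (m+[n∸m]≡n D≤e) (+-monoʳ-≤ D e∸D≤D)
      ...   | inj₂ q≤e∸D+D =
        contradiction (≤-trans q≤e∸D+D (≤-reflexive (m∸n+n≡m D≤e))) (<⇒≱ e<q)

      arc-from : ∀ {i₀ e₀} → J i₀ → J (rotate (start i₀) e₀) →
                 (∀ {i} → i < e₀ → ¬ J (rotate (start i₀) i)) →
                 ∀ {j} → J j → ∃ λ t → t ≤ D × rotate (rotate (start i₀) e₀) t ≡ j
      arc-from {i₀} {e₀} Ji₀ Js below {j} Je with e , e<q , refl ← rotate-reaches (start i₀) j =
        e ∸ e₀ , t≤D , s+t≡r+e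
        where
        e₀≤e : e₀ ≤ e
        e₀≤e = ≮⇒≥ (λ e<e₀ → below e<e₀ Je)
        s+t≡r+e : rotate (rotate (start i₀) e₀) (e ∸ e₀) ≡ rotate (start i₀) e
        s+t≡r+e = trans (rotate-+ (start i₀) e₀ (e ∸ e₀))
                        (cong (rotate (start i₀)) (m+[n∸m]≡n e₀≤e))
        t≤2D : e ∸ e₀ ≤ D + D
        t≤2D = ≤-trans (m∸n≤m e e₀) (offset≤2D Ji₀ e<q Je)
        t≤D : e ∸ e₀ ≤ D
        t≤D with cycDist-rotate-≤ (rotate (start i₀) e₀) (≤-<-trans (m∸n≤m e e₀) e<q)
                   (subst (λ z → cycDist q (rotate (start i₀) e₀) z ≤ D) (sym s+t≡r+e) (close Js Je))
        ... | inj₁ t≤D   = t≤D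
        ... | inj₂ q≤t+D = contradiction (≤-trans q≤t+D (+-monoˡ-≤ D t≤2D)) (<⇒≱ 3D<q)

    -- Every j ∈ J lies at most 2D after start i₀ = i₀ - D; as 3D < q, it then lies at
    -- most D after the first element of J from start i₀ on.
    arc-cover : ∃ λ s → ∀ {j} → J j → ∃ λ t → t ≤ D × rotate s t ≡ j
    arc-cover with Fin.any? J?
    ... | no  ¬J         = zero , λ {j} Jj → contradiction (j , Jj) ¬J
    ... | yes (i₀ , Ji₀)
      with e₀ , Js , _ , below ← minimal-witness (λ e → J? (rotate (start i₀) e))
                                                 (subst J (sym (start+D i₀)) Ji₀) =
      rotate (start i₀) e₀ , arc-from Ji₀ Js below

    ∑-⟦⟧-arc : ∑[ i < q ] ⟦ J? i ⟧ ≤ suc D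
    ∑-⟦⟧-arc with s , near ← arc-cover = ∑-⟦⟧-≤-arc J? s (suc D) λ Jj →
      let t , t≤D , s+t≡j = near Jj in t , s≤s t≤D , s+t≡j

    ∑-⟦⟧-arc-or-before : ∀ {I : Pred (Fin q) 0ℓ} (I? : Decidable I) →
                         (∀ {i} → I i → J i ⊎ J (rotate i 1)) → ∑[ i < q ] ⟦ I? i ⟧ ≤ suc (suc D)
    ∑-⟦⟧-arc-or-before {I} I? I⇒J with s , near ← arc-cover =
      ∑-⟦⟧-≤-arc I? s′ (suc (suc D)) near′
      where
      s′ : Fin q
      s′ = rotate s (q ∸ 1)
      s′+1+t≡s+t : ∀ t → rotate s′ (suc t) ≡ rotate s t
      s′+1+t≡s+t t = trans (sym (rotate-+ s′ 1 t)) (cong (λ z → rotate z t) (rotate-back s (s≤s z≤n)))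
      near′ : ∀ {i} → I i → ∃ λ t → t < suc (suc D) × rotate s′ t ≡ i
      near′ {i} Ii with I⇒J Ii
      ... | inj₁ Ji   with t , t≤D , refl ← near Ji = suc t , s≤s (s≤s t≤D) , s′+1+t≡s+t t
      ... | inj₂ Ji+1 with t , t≤D , s+t≡i+1 ← near Ji+1 = t , s≤s (m≤n⇒m≤1+n t≤D) , s′+t≡i
        where
        s′+t≡i : rotate s′ t ≡ i
        s′+t≡i = rotate-1-injective (trans (rotate-+ s′ t 1)
                   (trans (cong (rotate s′) (+-comm t 1)) (trans (s′+1+t≡s+t t) s+t≡i+1)))

-- Counting along an isometric cycle

data Parity : ℕ → Set where
  odd  : ∀ k → Parity (suc (k + k))
  even : ∀ k → Parity (suc (suc (k + k)))

parity : ∀ g → 1 ≤ g → Parity g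
parity (suc zero)          _ = odd 0
parity (suc (suc zero))    _ = even 0
parity (suc (suc (suc g))) _ with parity (suc g) (s≤s z≤n)
... | odd k  = subst Parity (cong (λ x → suc (suc x)) (+-suc k k)) (odd (suc k))
... | even k = subst Parity (cong (λ x → suc (suc (suc x))) (+-suc k k)) (even (suc k))

isOdd-odd : ∀ k → isOdd (suc (k + k)) ≡ true
isOdd-odd zero    = refl
isOdd-odd (suc k) rewrite +-suc k k = isOdd-odd k

isOdd-even : ∀ k → isOdd (k + k) ≡ false
isOdd-even zero    = refl
isOdd-even (suc k) rewrite +-suc k k = isOdd-even k

suc-suc-/2 : ∀ x → suc (suc x) / 2 ≡ suc (x / 2)
suc-suc-/2 x = divₕ-extractAcc 1 1 x 1

[k+k]/2≡k : ∀ k → (k + k) / 2 ≡ k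
[k+k]/2≡k zero    = refl
[k+k]/2≡k (suc k) rewrite +-suc k k = trans (suc-suc-/2 (k + k)) (cong suc ([k+k]/2≡k k))

[1+k+k]/2≡k : ∀ k → suc (k + k) / 2 ≡ k
[1+k+k]/2≡k zero    = refl
[1+k+k]/2≡k (suc k) rewrite +-suc k k = trans (suc-suc-/2 (suc (k + k))) (cong suc ([1+k+k]/2≡k k))

kOf-odd : ∀ k → kOf (suc (k + k)) ≡ k
kOf-odd k = begin
  suc (k + k + 1) / 2 ∸ 1      ≡⟨ cong (λ x → suc x / 2 ∸ 1) (+-comm (k + k) 1) ⟩
  suc (suc (k + k)) / 2 ∸ 1    ≡⟨ cong (_∸ 1) (suc-suc-/2 (k + k)) ⟩
  (k + k) / 2                  ≡⟨ [k+k]/2≡k k ⟩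
  k                            ∎
  where open ≡-Reasoning

kOf-even : ∀ k → kOf (suc (suc (k + k))) ≡ k
kOf-even k = begin
  suc (suc (k + k + 1)) / 2 ∸ 1   ≡⟨ cong (_∸ 1) (suc-suc-/2 (k + k + 1)) ⟩
  (k + k + 1) / 2                 ≡⟨ cong (_/ 2) (+-comm (k + k) 1) ⟩
  suc (k + k) / 2                 ≡⟨ [1+k+k]/2≡k k ⟩
  k                               ∎
  where open ≡-Reasoning

Moore-odd : ∀ δ k → Moore δ (suc (k + k)) ≡ 1 + sumBelow k (λ i → δ * (δ ∸ 1) ^ i)
Moore-odd δ k rewrite isOdd-odd k | kOf-odd k = refl

Moore-even : ∀ δ k → Moore δ (suc (suc (k + k))) ≡ 2 + sumBelow k (λ i → 2 * (δ ∸ 1) ^ suc i)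
Moore-even δ k rewrite isOdd-even k | kOf-even k = refl

6k+3<q⇒3[k+k]<q : ∀ k {q} → 6 * k + 3 < q → (k + k) + (k + k) + (k + k) < q
6k+3<q⇒3[k+k]<q k = ≤-<-trans (≤-trans (≤-reflexive (3[k+k]≡6k k)) (m≤m+n (6 * k) 3))
  where
  3[k+k]≡6k : ∀ k → (k + k) + (k + k) + (k + k) ≡ 6 * k
  3[k+k]≡6k = solve-∀

sumBelow-2* : ∀ k (f : ℕ → ℕ) → sumBelow k (λ i → 2 * f i) ≡ 2 * sumBelow k f
sumBelow-2* zero    f = refl
sumBelow-2* (suc k) f =
  trans (cong (_+ 2 * f k) (sumBelow-2* k f)) (sym (*-distribˡ-+ 2 (sumBelow k f) (f k)))

2+2*m≡1+m+1+m : ∀ m → 2 + 2 * m ≡ suc m + suc m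
2+2*m≡1+m+1+m m = cong suc (trans (cong (λ x → suc (m + x)) (+-identityʳ m)) (sym (+-suc m m)))

module OnIsometricCycle {n : ℕ} (G : Graph n) {δ m : ℕ} (δ≤deg : ∀ v → δ ≤ degree G v)
                        (C : Cycle G (suc m)) (isometric : Isometric C)
                        (k : ℕ) (6k<q : (k + k) + (k + k) + (k + k) < suc m) where
  open Paths G
  open Rotation m
  open DecMembership (Fin._≟_ {n}) using (_∈?_)

  c : Fin q → V
  c = vtx C

  c-edge : ∀ i → c i ~ c (rotate i 1)
  c-edge i = edges C i (rotate i 1) (rotate-1-Consecutive i)

  module Heads (g : ℕ) (girth≤ : ∀ L → Cycle G L → g ≤ L) where
    open MooreTree G g girth≤ δ δ≤deg public

    heads-close : ∀ {w i j s s′} → SimplePath (c i ∷ s) → SimplePath (c j ∷ s′) →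
                  w ∈ heads k (c i) s → w ∈ heads k (c j) s′ → cycDist q i j ≤ k + k
    heads-close {i = i} {j} P Q w∈ w∈′
      with l₁ , l₁≤k , walk₁ ← heads-walk k P w∈
      with l₂ , l₂≤k , walk₂ ← heads-walk k Q w∈′ =
      ≤-trans (proj₂ (isometric i j) _ (walk-++ (walk-reverse walk₁) walk₂)) (+-mono-≤ l₁≤k l₂≤k)

  odd-count : (∀ L → Cycle G L → suc (k + k) ≤ L) →
              suc m * (1 + sumBelow k (λ i → δ * (δ ∸ 1) ^ i)) ≤ n * suc (k + k)
  odd-count girth≤ = double-counting _ _ H unique size multiplicity
    where
    open Heads (suc (k + k)) girth≤
    H : Fin q → List V
    H i = heads k (c i) []
    unique : ∀ i → Unique (H i)
    unique i = Unique-heads k vertex-SimplePath ≤-refl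
    size : ∀ i → 1 + sumBelow k (λ i → δ * (δ ∸ 1) ^ i) ≤ length (H i)
    size i = subst (_ ≤_) (sym (length-heads k (c i) []))
               (length-tree k _ (λ i<k → length-layer-vertex _ (s≤s (≤-trans i<k (m≤m+n k k)))))
    multiplicity : ∀ w → ∑[ i < q ] ⟦ w ∈? H i ⟧ ≤ suc (k + k)
    multiplicity w =
      ∑-⟦⟧-arc (k + k) 6k<q (λ i → w ∈? H i) (heads-close vertex-SimplePath vertex-SimplePath)

  even-count : (∀ L → Cycle G L → suc (suc (k + k)) ≤ L) →
               suc m * (2 + sumBelow k (λ i → 2 * (δ ∸ 1) ^ suc i)) ≤ n * suc (suc (k + k))
  even-count girth≤ = double-counting _ _ H unique size multiplicity
    where
    open Heads (suc (suc (k + k))) girth≤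
    H : Fin q → List V
    H i = heads k (c i) [ c (rotate i 1) ] ++ heads k (c (rotate i 1)) [ c i ]
    unique : ∀ i → Unique (H i)
    unique i = Unique.++⁺ (Unique-heads k (edge-SimplePath (c-edge i)) (m<n⇒m<1+n ≤-refl))
                          (Unique-heads k (edge-SimplePath (~-sym (c-edge i))) (m<n⇒m<1+n ≤-refl))
                          (heads-edge-disjoint k (c-edge i) ≤-refl)
    S : ℕ
    S = sumBelow k (λ i → (δ ∸ 1) ^ suc i)
    half-size : ∀ {a b} → a ~ b → 1 + S ≤ length (heads k a [ b ])
    half-size {a} {b} a~b = subst (_ ≤_) (sym (length-heads k a [ b ]))
      (length-tree k _ (λ i<k → length-layer-edge a~b _ (s≤s (s≤s (≤-trans i<k (m≤m+n k k))))))
    size : ∀ i → 2 + sumBelow k (λ i → 2 * (δ ∸ 1) ^ suc i) ≤ length (H i)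
    size i = begin
      2 + sumBelow k (λ i → 2 * (δ ∸ 1) ^ suc i)
        ≡⟨ cong (2 +_) (sumBelow-2* k _) ⟩
      2 + 2 * S
        ≡⟨ 2+2*m≡1+m+1+m S ⟩
      suc S + suc S
        ≤⟨ +-mono-≤ (half-size (c-edge i)) (half-size (~-sym (c-edge i))) ⟩
      length (heads k (c i) [ c (rotate i 1) ]) + length (heads k (c (rotate i 1)) [ c i ])
        ≡⟨ length-++ (heads k (c i) [ c (rotate i 1) ]) ⟨
      length (H i)
        ∎
      where open ≤-Reasoning
    Near : V → Fin q → Set
    Near w j = ∃ λ x → c j ~ x × w ∈ heads k (c j) [ x ]
    Near? : ∀ w j → Dec (Near w j)
    Near? w j = Fin.any? (λ x → (c j ~? x) ×-dec (w ∈? heads k (c j) [ x ]))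
    multiplicity : ∀ w → ∑[ i < q ] ⟦ w ∈? H i ⟧ ≤ suc (suc (k + k))
    multiplicity w = ∑-⟦⟧-arc-or-before (k + k) 6k<q (Near? w)
      (λ (_ , cᵢ~x , w∈) (_ , cⱼ~y , w∈′) →
         heads-close (edge-SimplePath cᵢ~x) (edge-SimplePath cⱼ~y) w∈ w∈′)
      (λ i → w ∈? H i) near
      where
      near : ∀ {i} → w ∈ H i → Near w i ⊎ Near w (rotate i 1)
      near {i} w∈ with ∈-++⁻ (heads k (c i) [ c (rotate i 1) ]) w∈
      ... | inj₁ w∈ᵢ   = inj₁ (_ , c-edge i , w∈ᵢ)
      ... | inj₂ w∈ᵢ₊₁ = inj₂ (_ , ~-sym (c-edge i) , w∈ᵢ₊₁)

theorem8 : ∀ (n : ℕ) (G : Graph n) (g δ q : ℕ) →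
    Girth G g → 3 ≤ g →
    MinDegree G δ → 2 ≤ δ →
    Equator G q →
    6 * kOf g + 3 < q →
    q * Moore δ g ≤ n * g
theorem8 n G g δ zero _ _ _ _ _ ()
theorem8 n G g δ (suc m) (_ , girth≤) 3≤g (δ≤deg , _) _ ((C , isometric) , _) 6k+3<q
  with parity g (≤-trans (s≤s z≤n) 3≤g)
... | odd k rewrite Moore-odd δ k =
  OnIsometricCycle.odd-count G δ≤deg C isometric k
    (6k+3<q⇒3[k+k]<q k (subst (λ k′ → 6 * k′ + 3 < suc m) (kOf-odd k) 6k+3<q)) girth≤
... | even k rewrite Moore-even δ k =
  OnIsometricCycle.even-count G δ≤deg C isometric k
    (6k+3<q⇒3[k+k]<q k (subst (λ k′ → 6 * k′ + 3 < suc m) (kOf-even k) 6k+3<q)) girth≤
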